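{- In the setting below, let $\rho,\rho'$ be rotor configurations. The following are equivalent: (a) $\sigma\rho=\sigma\rho'$ for some particle configuration $\sigma$; (b) $\sigma\rho=\sigma\rho'$ for all recurrent configurations $\sigma\in S(G/T)$; (c) $e\rho=e\rho'$, where $e$ is the identity element of $S(G/T)$; (d) $\sigma\rho=\sigma\rho'$ for all particle configurations $\sigma$ with $\sigma(v)\ge e(v)$ for all $v\in V_0$.
   Context: $G=(V,E)$ is a finite strongly connected directed graph (loops and multiple arcs allowed), $T\subseteq V$ a nonempty set of targets, $V_0=V\setminus T$, $d(v)$ the out-degree. At each $v\in V_0$ a rotor mechanism is fixed: an ordering $e_v^1,\dots,e_v^{d(v)}$ of the arcs leaving $v$, extended periodically; for $e=e_v^i$ put $e^+=e_v^{i+1}$. A rotor configuration is a map $\rho:V_0\to E$ with $\rho(v)$ an arc leaving $v$. A particle at $v\in V_0$ steps by replacing $\rho(v)$ with $\rho(v)^+$ and moving along the new $\rho(v)$; particles stop on reaching $T$. A particle configuration is a map $\sigma:V_0\to\mathbb{N}$; $\sigma\rho$ is the rotor configuration obtained by placing $\sigma(v)$ particles at each $v$ and letting all step until each reaches $T$ (independent of order). $\sigma$ is stable if $\sigma(v)\le d(v)-1$ for all $v$; toppling an unstable $v$ sends one particle along each arc leaving $v$ (particles reaching $T$ disappear), and repeated toppling yields a stable $\sigma^\circ$ independent of order. Stable configurations form a commutative monoid under $(\sigma_1,\sigma_2)\mapsto(\sigma_1+\sigma_2)^\circ$; a stable $\tau$ is recurrent if for every particle configuration $\sigma$ there is $\tau'$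 with $\tau=(\tau'+\sigma)^\circ$. The recurrent configurations form an abelian group $S(G/T)$ (sandpile group) under this operation, with identity $e$. -}

module Defs where

open import Data.Nat using (ℕ; zero; suc; _+_; _∸_; _≤_; _<_)
open import Data.Nat.DivMod using (_mod_)
open import Data.Fin using (Fin; toℕ; _≟_)
import Data.Fin
open import Data.Bool using (Bool; true; false; if_then_else_)
open import Data.Product using (Σ; ∃; ∃-syntax; _×_; _,_)
open import Relation.Nullary.Decidable using (⌊_⌋)
open import Relation.Nullary using (yes; no)
open import Relation.Binary.PropositionalEquality using (_≡_; refl)
open import Relation.Binary.Construct.Closure.ReflexiveTransitive using (Star)

-- A finite directed multigraph (loops and multiple arcs allowed) with target set T
-- and a rotor mechanism: the arcs leaving v are indexed by Fin (d v) in rotor order,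
-- arc i leaving v has head (head v i).
record RotorGraph : Set where
  field
    n    : ℕ
    T    : Fin n → Bool
    d    : Fin n → ℕ
    head : (v : Fin n) → Fin (d v) → Fin n

cyc : ∀ {k} → Fin k → Fin k
cyc {suc k} i = suc (toℕ i) mod suc k

module _ (G : RotorGraph) where
  open RotorGraph G

  Arc : Fin n → Fin n → Set
  Arc u w = Σ (Fin (d u)) λ i → head u i ≡ w

  StronglyConnected : Set
  StronglyConnected = ∀ u w → Star Arc u w

  TargetsNonempty : Set
  TargetsNonempty = ∃[ t ] T t ≡ true

  NonTarget : Fin n → Set
  NonTarget v = T v ≡ false

  RotorConfig : Set
  RotorConfig = (v : Fin n) → NonTarget v → Fin (d v)

  _≈ʳ_ : RotorConfig → RotorConfig → Set
  ρ ≈ʳ ρ' = ∀ v (p : NonTarget v) → ρ v p ≡ ρ' v p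

  -- particle configuration: values at targets are ignored (configs are maps V₀ → ℕ)
  PConfig : Set
  PConfig = Fin n → ℕ

  _≈ᵖ_ : PConfig → PConfig → Set
  σ ≈ᵖ τ = ∀ v → NonTarget v → σ v ≡ τ v

  _⊕_ : PConfig → PConfig → PConfig
  (σ ⊕ τ) v = σ v + τ v

  [_≡?_] : Fin n → Fin n → Bool
  [ u ≡? v ] = ⌊ u ≟ v ⌋

  δ : Fin n → Fin n → ℕ
  δ v u = if [ u ≡? v ] then 1 else 0

  advance : RotorConfig → Fin n → RotorConfig
  advance ρ v u q with u ≟ v
  ... | yes refl = cyc (ρ v q)
  ... | no _ = ρ u q

  data Step : PConfig × RotorConfig → PConfig × RotorConfig → Set where
    step : ∀ σ ρ v (p : NonTarget v) → 1 ≤ σ v →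
      let w = head v (cyc (ρ v p)) in
      Step (σ , ρ)
           ((λ u → if T u then σ u else (σ u ∸ δ v u) + δ w u) , advance ρ v)

  -- σρ ≡ r : placing σ particles on ρ and routing all of them to T yields r
  Routes : PConfig → RotorConfig → RotorConfig → Set
  Routes σ ρ r = ∃[ σ' ] (Star Step (σ , ρ) (σ' , r) × (∀ v → NonTarget v → σ' v ≡ 0))

  SameResult : PConfig → RotorConfig → RotorConfig → Set
  SameResult σ ρ ρ' = ∃[ r ] ∃[ r' ] (Routes σ ρ r × Routes σ ρ' r' × r ≈ʳ r')

  countFin : (k : ℕ) → (Fin k → Bool) → ℕ
  countFin zero f = 0
  countFin (suc k) f = (if f Data.Fin.zero then 1 else 0) + countFin k (λ i → f (Data.Fin.suc i))

  arcs : Fin n → Fin n → ℕ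
  arcs v u = countFin (d v) (λ i → [ head v i ≡? u ])

  Stable : PConfig → Set
  Stable σ = ∀ v → NonTarget v → σ v < d v

  data Topple : PConfig → PConfig → Set where
    topple : ∀ σ v → NonTarget v → d v ≤ σ v →
      Topple σ (λ u → if T u then σ u
                      else (σ u ∸ (if [ u ≡? v ] then d v else 0)) + arcs v u)

  StabilizesTo : PConfig → PConfig → Set
  StabilizesTo σ τ = ∃[ τ' ] (Star Topple σ τ' × Stable τ' × τ' ≈ᵖ τ)

  Recurrent : PConfig → Set
  Recurrent τ = Stable τ × (∀ σ → ∃[ τ' ] StabilizesTo (τ' ⊕ σ) τ)

  IsIdentity : PConfig → Set
  IsIdentity e = Recurrent e × (∀ τ → Recurrent τ → StabilizesTo (τ ⊕ e) τ)

module Submission where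

-- Two loaded vertices can fire in either order with the same result, so all halting runs from a
-- state end in the same state, and σρ is well defined. Strong connectivity makes every state halt:
-- by induction on a set of active vertices, drain all active vertices but one, v, that has an arc i
-- leaving the set, then fire v; the potential (rotor advances from ρ(v) to i) + d(v)·(particles on
-- active vertices) drops with every firing of v. Toppling v is d(v) firings of v, which send one
-- particle along each arc and return the rotor of v to its start, so σρ only depends on the
-- stabilization of σ. Placing σ + τ on ρ routes σ first and τ afterwards from σρ, so σρ = σρ'
-- implies (σ + τ)ρ = (σ + τ)ρ'. Then (a) ⇒ (b) because every recurrent τ is (τ' + σ)°, and
-- (c) ⇒ (d) because σ = e + (σ ∸ e).

open import Defs
open import Data.Nat using (ℕ; zero; suc; _+_; _*_; _∸_; _≤_; _<_; z≤n; _<?_; NonZero; s≤s⁻¹)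
import Data.Nat as ℕ
open import Data.Nat.Properties hiding (_≟_)
open import Data.Nat.DivMod using (_mod_; _%_; m<n⇒m%n≡m; [m+n]%n≡m%n; %-distribˡ-+; m%n%n≡m%n; n%n≡0)
open import Data.Fin using (Fin; toℕ; _≟_) renaming (zero to fzero; suc to fsuc)
open import Data.Fin.Properties using (toℕ-injective; toℕ<n; toℕ-fromℕ<; nonZeroIndex; any?)
  renaming (suc-injective to fsuc-injective)
open import Data.Bool using (Bool; true; false; if_then_else_; not; _∧_)
import Data.Bool.Properties as Bool
open import Data.Product using (Σ; ∃-syntax; _×_; _,_; proj₁; proj₂)
open import Data.Sum using (_⊎_; inj₁; inj₂)
open import Data.Empty using (⊥-elim)
open import Relation.Nullary using (yes; no; ¬_; Dec)
open import Relation.Nullary.Decidable using (⌊_⌋)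
open import Relation.Binary.PropositionalEquality
open import Relation.Binary.Construct.Closure.ReflexiveTransitive using (Star; ε; _◅_)
open import Axiom.UniquenessOfIdentityProofs using (module Decidable⇒UIP)
open import Algebra.Properties.CommutativeMonoid.Sum +-0-commutativeMonoid
  using (sum-syntax; sum-cong-≗; ∑-distrib-+; sum-replicate-zero)

if-true : {A : Set} {b : Bool} {x y : A} → b ≡ true → (if b then x else y) ≡ x
if-true refl = refl

if-false : {A : Set} {b : Bool} {x y : A} → b ≡ false → (if b then x else y) ≡ y
if-false refl = refl

∸-+-exchange : ∀ s a b c e → a + c ≤ s → (s ∸ a) + b ∸ c + e ≡ (s ∸ c) + e ∸ a + b
∸-+-exchange s a b c e a+c≤s = begin
  (s ∸ a) + b ∸ c + e    ≡⟨ cong (_+ e) (+-∸-comm b c≤s∸a) ⟩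
  (s ∸ a ∸ c) + b + e    ≡⟨ cong (λ t → t + b + e) ∸-comm ⟩
  (s ∸ c ∸ a) + b + e    ≡⟨ +-assoc (s ∸ c ∸ a) b e ⟩
  (s ∸ c ∸ a) + (b + e)  ≡⟨ cong ((s ∸ c ∸ a) +_) (+-comm b e) ⟩
  (s ∸ c ∸ a) + (e + b)  ≡⟨ +-assoc (s ∸ c ∸ a) e b ⟨
  (s ∸ c ∸ a) + e + b    ≡⟨ cong (_+ b) (+-∸-comm e a≤s∸c) ⟨
  (s ∸ c) + e ∸ a + b    ∎
  where
  open ≡-Reasoning
  c≤s∸a : c ≤ s ∸ a
  c≤s∸a = m+n≤o⇒m≤o∸n c (subst (_≤ s) (+-comm a c) a+c≤s)
  a≤s∸c : a ≤ s ∸ c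
  a≤s∸c = m+n≤o⇒m≤o∸n a a+c≤s
  ∸-comm : s ∸ a ∸ c ≡ s ∸ c ∸ a
  ∸-comm = trans (∸-+-assoc s a c) (trans (cong (s ∸_) (+-comm a c)) (sym (∸-+-assoc s c a)))

m∸1+n+1≡m+n : ∀ m n → 1 ≤ m → m ∸ 1 + n + 1 ≡ m + n
m∸1+n+1≡m+n (suc m) n _ = +-comm (m + n) 1

⌊≟⌋-refl : ∀ {k} (u : Fin k) → ⌊ u ≟ u ⌋ ≡ true
⌊≟⌋-refl u with u ≟ u
... | yes _ = refl
... | no u≢u = ⊥-elim (u≢u refl)

⌊≟⌋-≢ : ∀ {k} {u v : Fin k} → u ≢ v → ⌊ u ≟ v ⌋ ≡ false
⌊≟⌋-≢ {u = u} {v} u≢v with u ≟ v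
... | yes u≡v = ⊥-elim (u≢v u≡v)
... | no _ = refl

⌊≟⌋-sym : ∀ {k} (u v : Fin k) → ⌊ u ≟ v ⌋ ≡ ⌊ v ≟ u ⌋
⌊≟⌋-sym u v with u ≟ v
... | yes refl = sym (⌊≟⌋-refl u)
... | no u≢v = sym (⌊≟⌋-≢ (λ v≡u → u≢v (sym v≡u)))

⌊≟⌋-fsuc : ∀ {k} (u v : Fin k) → ⌊ fsuc u ≟ fsuc v ⌋ ≡ ⌊ u ≟ v ⌋
⌊≟⌋-fsuc u v = by-cases (u ≟ v)
  where
  by-cases : Dec (u ≡ v) → ⌊ fsuc u ≟ fsuc v ⌋ ≡ ⌊ u ≟ v ⌋
  by-cases (yes refl) = trans (⌊≟⌋-refl (fsuc u)) (sym (⌊≟⌋-refl u))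
  by-cases (no u≢v) = trans (⌊≟⌋-≢ (λ eq → u≢v (fsuc-injective eq))) (sym (⌊≟⌋-≢ u≢v))

∑-indicator : ∀ {k} (v : Fin k) c → ∑[ u < k ] (if ⌊ u ≟ v ⌋ then c else 0) ≡ c
∑-indicator {suc k} fzero c = trans (cong (c +_) (sum-replicate-zero k)) (+-identityʳ c)
∑-indicator {suc k} (fsuc v) c =
  trans (sum-cong-≗ (λ u → cong (if_then c else 0) (⌊≟⌋-fsuc u v))) (∑-indicator v c)

cyc-mod : ∀ {m} .{{_ : NonZero m}} j → cyc {m} (j mod m) ≡ suc j mod m
cyc-mod {suc m} j = toℕ-injective (begin
  toℕ (cyc (j mod d))          ≡⟨ toℕ-fromℕ< _ ⟩
  (1 + toℕ (j mod d)) % d      ≡⟨ cong (λ a → (1 + a) % d) (toℕ-fromℕ< _) ⟩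
  (1 + j % d) % d              ≡⟨ %-distribˡ-+ 1 (j % d) d ⟩
  (1 % d + j % d % d) % d      ≡⟨ cong (λ a → (1 % d + a) % d) (m%n%n≡m%n j d) ⟩
  (1 % d + j % d) % d          ≡⟨ %-distribˡ-+ 1 j d ⟨
  (1 + j) % d                  ≡⟨ toℕ-fromℕ< _ ⟨
  toℕ (suc j mod d)            ∎)
  where
  open ≡-Reasoning
  d = suc m

mod-toℕ : ∀ {m} .{{_ : NonZero m}} (r : Fin m) → toℕ r mod m ≡ r
mod-toℕ {suc m} r = toℕ-injective (trans (toℕ-fromℕ< _) (m<n⇒m%n≡m (toℕ<n r)))

mod-+-period : ∀ {m} .{{_ : NonZero m}} j → (j + m) mod m ≡ j mod m
mod-+-period {suc m} j =
  toℕ-injective (trans (toℕ-fromℕ< _) (trans ([m+n]%n≡m%n j (suc m)) (sym (toℕ-fromℕ< _))))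

∑-window : (ℕ → ℕ) → ℕ → ℕ → ℕ
∑-window h b zero = 0
∑-window h b (suc k) = h b + ∑-window h (suc b) k

∑-window-snoc : ∀ h b k → ∑-window h b (suc k) ≡ ∑-window h b k + h (b + k)
∑-window-snoc h b zero = trans (+-identityʳ (h b)) (cong h (sym (+-identityʳ b)))
∑-window-snoc h b (suc k) = begin
  h b + ∑-window h (suc b) (suc k)          ≡⟨ cong (h b +_) (∑-window-snoc h (suc b) k) ⟩
  h b + (∑-window h (suc b) k + h (suc b + k)) ≡⟨ +-assoc (h b) _ _ ⟨
  h b + ∑-window h (suc b) k + h (suc b + k)   ≡⟨ cong (λ j → h b + ∑-window h (suc b) k + h j) (+-suc b k) ⟨
  h b + ∑-window h (suc b) k + h (b + suc k)   ∎
  where open ≡-Reasoning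

∑-window-periodic : ∀ h m → (∀ j → h (j + m) ≡ h j) → ∀ b → ∑-window h b m ≡ ∑-window h 0 m
∑-window-periodic h m period zero = refl
∑-window-periodic h m period (suc b) = trans shift (∑-window-periodic h m period b)
  where
  shift : ∑-window h (suc b) m ≡ ∑-window h b m
  shift = +-cancelˡ-≡ (h b) _ _ (begin
    h b + ∑-window h (suc b) m  ≡⟨ ∑-window-snoc h b m ⟩
    ∑-window h b m + h (b + m)  ≡⟨ cong (∑-window h b m +_) (period b) ⟩
    ∑-window h b m + h b        ≡⟨ +-comm _ (h b) ⟩
    h b + ∑-window h b m        ∎)
    where open ≡-Reasoning

∑-window-countFin : ∀ G k (f : Fin k → Bool) h b → (∀ i → h (b + toℕ i) ≡ (if f i then 1 else 0)) →
                    ∑-window h b k ≡ countFin G k f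
∑-window-countFin G zero f h b h≡f = refl
∑-window-countFin G (suc k) f h b h≡f = cong₂ _+_
  (trans (cong h (sym (+-identityʳ b))) (h≡f fzero))
  (∑-window-countFin G k (λ i → f (fsuc i)) h (suc b)
    (λ i → trans (cong h (sym (+-suc b (toℕ i)))) (h≡f (fsuc i))))

-- the number of steps a ↦ a + 1 (mod m) from a to g, counted in 1 … m
cycleGap : ℕ → ℕ → ℕ → ℕ
cycleGap m g a with a <? g
... | yes _ = g ∸ a
... | no _ = g + m ∸ a

cycleGap-< : ∀ m {g a} → a < g → cycleGap m g a ≡ g ∸ a
cycleGap-< m {g} {a} a<g with a <? g
... | yes _ = refl
... | no a≮g = ⊥-elim (a≮g a<g)

cycleGap-≮ : ∀ m {g a} → ¬ a < g → cycleGap m g a ≡ g + m ∸ a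
cycleGap-≮ m {g} {a} a≮g with a <? g
... | yes a<g = ⊥-elim (a≮g a<g)
... | no _ = refl

cycleGap-suc : ∀ m {g a} → suc a < m → suc a ≢ g → cycleGap m g (suc a) < cycleGap m g a
cycleGap-suc m {g} {a} 1+a<m 1+a≢g with a <? g
... | yes a<g = begin-strict
  cycleGap m g (suc a)  ≡⟨ cycleGap-< m (≤∧≢⇒< a<g 1+a≢g) ⟩
  g ∸ suc a             <⟨ ∸-monoʳ-< (n<1+n a) a<g ⟩
  g ∸ a                 ∎
  where open ≤-Reasoning
... | no a≮g = begin-strict
  cycleGap m g (suc a)  ≡⟨ cycleGap-≮ m (λ 1+a<g → a≮g (<-trans (n<1+n a) 1+a<g)) ⟩
  g + m ∸ suc a         <⟨ ∸-monoʳ-< (n<1+n a) (≤-trans (<⇒≤ 1+a<m) (m≤n+m m g)) ⟩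
  g + m ∸ a             ∎
  where open ≤-Reasoning

cycleGap-wrap : ∀ m {g a} → suc a ≡ m → g < m → 0 ≢ g → cycleGap m g 0 < cycleGap m g a
cycleGap-wrap m {g} {a} refl g<m 0≢g = begin-strict
  cycleGap m g 0    ≡⟨ cycleGap-< m (≤∧≢⇒< z≤n 0≢g) ⟩
  g                 <⟨ n<1+n g ⟩
  suc g             ≡⟨ cong suc (m+n∸n≡m g a) ⟨
  suc (g + a ∸ a)   ≡⟨ +-∸-assoc 1 (m≤n+m a g) ⟨
  suc (g + a) ∸ a   ≡⟨ cong (_∸ a) (+-suc g a) ⟨
  g + suc a ∸ a     ≡⟨ cycleGap-≮ m (λ a<g → <-irrefl refl (≤-trans g<m a<g)) ⟨
  cycleGap m g a    ∎
  where open ≤-Reasoning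

gap : ∀ {m} → Fin m → Fin m → ℕ
gap {m} i r = cycleGap m (toℕ i) (toℕ r)

gap-self : ∀ {m} (i : Fin m) → gap i i ≡ m
gap-self {m} i = trans (cycleGap-≮ m {toℕ i} (<-irrefl refl)) (m+n∸m≡n (toℕ i) m)

gap-positive : ∀ {m} (i r : Fin m) → 0 < gap i r
gap-positive {m} i r with toℕ r <? toℕ i
... | yes r<i = m<n⇒0<n∸m r<i
... | no _ = m<n⇒0<n∸m (≤-trans (toℕ<n r) (m≤n+m m (toℕ i)))

gap-cyc : ∀ {m} (i r : Fin m) → cyc r ≡ i ⊎ gap i (cyc r) < gap i r
gap-cyc {suc m} i r with cyc r ≟ i
... | yes hit = inj₁ hit
... | no miss with suc (toℕ r) <? suc m
...   | yes 1+r<d = inj₂ (subst (λ a → cycleGap (suc m) (toℕ i) a < gap i r) (sym toℕ-cyc)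
                          (cycleGap-suc (suc m) 1+r<d (λ eq → miss (toℕ-injective (trans toℕ-cyc eq)))))
  where
  toℕ-cyc : toℕ (cyc r) ≡ suc (toℕ r)
  toℕ-cyc = trans (toℕ-fromℕ< _) (m<n⇒m%n≡m 1+r<d)
...   | no 1+r≮d = inj₂ (subst (λ a → cycleGap (suc m) (toℕ i) a < gap i r) (sym toℕ-cyc)
                          (cycleGap-wrap (suc m) 1+r≡d (toℕ<n i)
                            (λ eq → miss (toℕ-injective (trans toℕ-cyc eq)))))
  where
  1+r≡d : suc (toℕ r) ≡ suc m
  1+r≡d = ≤-antisym (toℕ<n r) (≮⇒≥ 1+r≮d)
  toℕ-cyc : toℕ (cyc r) ≡ 0
  toℕ-cyc = trans (toℕ-fromℕ< _) (trans (cong (_% suc m) 1+r≡d) (n%n≡0 (suc m)))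

module Rotor (G : RotorGraph) where
  open RotorGraph G

  State : Set
  State = PConfig G × RotorConfig G

  VertexSet : Set
  VertexSet = Fin n → Bool

  -- without function extensionality, states are compared pointwise on V₀
  infix 4 _≋_
  _≋_ : State → State → Set
  x ≋ y = _≈ᵖ_ G (proj₁ x) (proj₁ y) × _≈ʳ_ G (proj₂ x) (proj₂ y)

  ≋-refl : ∀ {x} → x ≋ x
  ≋-refl = (λ _ _ → refl) , (λ _ _ → refl)

  ≋-sym : ∀ {x y} → x ≋ y → y ≋ x
  ≋-sym (σ≈τ , ρ≈ρ') = (λ v p → sym (σ≈τ v p)) , (λ v p → sym (ρ≈ρ' v p))

  ≋-trans : ∀ {x y z} → x ≋ y → y ≋ z → x ≋ z
  ≋-trans (σ≈ , ρ≈) (τ≈ , ρ'≈) =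
    (λ v p → trans (σ≈ v p) (τ≈ v p)) , (λ v p → trans (ρ≈ v p) (ρ'≈ v p))

  -- particles that reach a target disappear: the configuration never changes there
  moveParticle : PConfig G → Fin n → Fin n → PConfig G
  moveParticle σ v w u = if T u then σ u else (σ u ∸ δ G v u) + δ G w u

  fire : State → (v : Fin n) → NonTarget G v → State
  fire (σ , ρ) v p = moveParticle σ v (head v (cyc (ρ v p))) , advance G ρ v

  advance-self : ∀ ρ v q → advance G ρ v v q ≡ cyc (ρ v q)
  advance-self ρ v q with v ≟ v
  ... | yes refl = refl
  ... | no v≢v = ⊥-elim (v≢v refl)

  advance-other : ∀ ρ {v u} q → u ≢ v → advance G ρ v u q ≡ ρ u q
  advance-other ρ {v} {u} q u≢v with u ≟ v
  ... | yes u≡v = ⊥-elim (u≢v u≡v)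
  ... | no _ = refl

  advance-cong : ∀ {ρ ρ'} v → _≈ʳ_ G ρ ρ' → _≈ʳ_ G (advance G ρ v) (advance G ρ' v)
  advance-cong v ρ≈ρ' u q with u ≟ v
  ... | yes refl = cong cyc (ρ≈ρ' v q)
  ... | no _ = ρ≈ρ' u q

  fire-cong : ∀ {x y} v p → x ≋ y → fire x v p ≋ fire y v p
  fire-cong {x} {y} v p (σ≈τ , ρ≈ρ') = moved , advance-cong v ρ≈ρ'
    where
    moved : _≈ᵖ_ G (proj₁ (fire x v p)) (proj₁ (fire y v p))
    moved u q rewrite q | σ≈τ u q | ρ≈ρ' v p = refl

  advance-comm : ∀ ρ {v w} → v ≢ w → _≈ʳ_ G (advance G (advance G ρ w) v) (advance G (advance G ρ v) w)
  advance-comm ρ {v} {w} v≢w u q = by-cases (u ≟ v) (u ≟ w)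
    where
    by-cases : Dec (u ≡ v) → Dec (u ≡ w) → advance G (advance G ρ w) v u q ≡ advance G (advance G ρ v) w u q
    by-cases (yes refl) (yes refl) = ⊥-elim (v≢w refl)
    by-cases (yes refl) (no u≢w) = begin
      advance G (advance G ρ w) u u q  ≡⟨ advance-self _ u q ⟩
      cyc (advance G ρ w u q)          ≡⟨ cong cyc (advance-other ρ q u≢w) ⟩
      cyc (ρ u q)                      ≡⟨ advance-self ρ u q ⟨
      advance G ρ u u q                ≡⟨ advance-other _ q u≢w ⟨
      advance G (advance G ρ u) w u q  ∎
      where open ≡-Reasoning
    by-cases (no u≢v) (yes refl) = begin
      advance G (advance G ρ u) v u q  ≡⟨ advance-other _ q u≢v ⟩
      advance G ρ u u q                ≡⟨ advance-self ρ u q ⟩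
      cyc (ρ u q)                      ≡⟨ cong cyc (advance-other ρ q u≢v) ⟨
      cyc (advance G ρ v u q)          ≡⟨ advance-self _ u q ⟨
      advance G (advance G ρ v) u u q  ∎
      where open ≡-Reasoning
    by-cases (no u≢v) (no u≢w) = begin
      advance G (advance G ρ w) v u q  ≡⟨ advance-other _ q u≢v ⟩
      advance G ρ w u q                ≡⟨ advance-other ρ q u≢w ⟩
      ρ u q                            ≡⟨ advance-other ρ q u≢v ⟨
      advance G ρ v u q                ≡⟨ advance-other _ q u≢w ⟨
      advance G (advance G ρ v) w u q  ∎
      where open ≡-Reasoning

  δ-≤ : ∀ (σ : PConfig G) {v} u → 1 ≤ σ v → δ G v u ≤ σ u
  δ-≤ σ {v} u loaded with u ≟ v
  ... | yes refl = loaded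
  ... | no _ = z≤n

  δ-other : ∀ {v u} → u ≢ v → δ G v u ≡ 0
  δ-other u≢v = if-false (⌊≟⌋-≢ u≢v)

  moveParticle-comm : ∀ σ {v w} v' w' → v ≢ w → 1 ≤ σ v → 1 ≤ σ w →
                      _≈ᵖ_ G (moveParticle (moveParticle σ w w') v v') (moveParticle (moveParticle σ v v') w w')
  moveParticle-comm σ {v} {w} v' w' v≢w loaded-v loaded-w u q rewrite q =
    ∸-+-exchange (σ u) (δ G w u) (δ G w' u) (δ G v u) (δ G v' u) room
    where
    room : δ G w u + δ G v u ≤ σ u
    room with u ≟ w | u ≟ v
    ... | yes refl | yes refl = ⊥-elim (v≢w refl)
    ... | yes refl | no _ = loaded-w
    ... | no _ | yes refl = loaded-v
    ... | no _ | no _ = z≤n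

  fire-comm : ∀ x {v w} p q → v ≢ w → 1 ≤ proj₁ x v → 1 ≤ proj₁ x w →
              fire (fire x w q) v p ≋ fire (fire x v p) w q
  fire-comm (σ , ρ) {v} {w} p q v≢w loaded-v loaded-w
    rewrite advance-other ρ p v≢w | advance-other ρ q (λ w≡v → v≢w (sym w≡v)) =
    moveParticle-comm σ _ _ v≢w loaded-v loaded-w , advance-comm ρ v≢w

  fire-irrelevant : ∀ x v (p q : NonTarget G v) → fire x v p ≋ fire x v q
  fire-irrelevant x v p q rewrite Decidable⇒UIP.≡-irrelevant Bool._≟_ p q = ≋-refl

  -- The abelian property
  record Move (A : VertexSet) (x y : State) : Set where
    constructor move
    field
      vertex : Fin n
      nonTarget : NonTarget G vertex
      allowed : A vertex ≡ true
      loaded : 1 ≤ proj₁ x vertex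
      result : fire x vertex nonTarget ≋ y

  infixr 5 _∷_
  data Run (A : VertexSet) : State → State → Set where
    [_] : ∀ {x y} → x ≋ y → Run A x y
    _∷_ : ∀ {x y z} → Move A x y → Run A y z → Run A x z

  everywhere : VertexSet
  everywhere _ = true

  infix 4 _⇝_
  _⇝_ : State → State → Set
  _⇝_ = Run everywhere

  Halted : State → Set
  Halted x = ∀ u → NonTarget G u → proj₁ x u ≡ 0

  halted-cong : ∀ {x y} → x ≋ y → Halted x → Halted y
  halted-cong x≋y halted u q = trans (sym (proj₁ x≋y u q)) (halted u q)

  ≤-moveParticle : ∀ σ {v w} w' → NonTarget G v → v ≢ w → σ v ≤ moveParticle σ w w' v
  ≤-moveParticle σ {v} w' p v≢w rewrite p | δ-other v≢w = m≤m+n (σ v) _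

  module _ {A : VertexSet} where

    move-cong-src : ∀ {x x' y} → x ≋ x' → Move A x' y → Move A x y
    move-cong-src x≋x' (move v p a loaded fired) =
      move v p a (subst (1 ≤_) (sym (proj₁ x≋x' v p)) loaded) (≋-trans (fire-cong v p x≋x') fired)

    run-cong-src : ∀ {x x' y} → x ≋ x' → Run A x' y → Run A x y
    run-cong-src x≋x' [ x'≋y ] = [ ≋-trans x≋x' x'≋y ]
    run-cong-src x≋x' (m ∷ r) = move-cong-src x≋x' m ∷ r

    run-cong-tgt : ∀ {x y y'} → Run A x y → y ≋ y' → Run A x y'
    run-cong-tgt [ x≋y ] y≋y' = [ ≋-trans x≋y y≋y' ]
    run-cong-tgt (m ∷ r) y≋y' = m ∷ run-cong-tgt r y≋y'

    infixr 5 _++_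
    _++_ : ∀ {x y z} → Run A x y → Run A y z → Run A x z
    [ x≋y ] ++ r = run-cong-src x≋y r
    (m ∷ r) ++ r' = m ∷ (r ++ r')

    halted-stuck : ∀ {x y} → Halted x → ¬ Move A x y
    halted-stuck halted (move v p _ loaded _) with () ← subst (1 ≤_) (halted v p) loaded

    -- the given move commutes past the moves of the run that precede its own firing of the same vertex
    exchange : ∀ {x y h} → Run A x h → Halted h → Move A x y → Run A y h
    exchange [ x≋h ] halted m = ⊥-elim (halted-stuck (halted-cong (≋-sym x≋h) halted) m)
    exchange {x} {y} (_∷_ {y = x'} (move w q aw lw fired-w) r) halted (move v p av lv fired-v) with w ≟ v
    ... | yes refl = run-cong-src (≋-trans (≋-sym fired-v) (≋-trans (fire-irrelevant x w p q) fired-w)) r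
    ... | no w≢v = move w q aw lw' fired-w' ∷ exchange r halted (move v p av lv' ≋-refl)
      where
      v≢w : v ≢ w
      v≢w v≡w = w≢v (sym v≡w)
      lv' : 1 ≤ proj₁ x' v
      lv' = subst (1 ≤_) (proj₁ fired-w v p) (≤-trans lv (≤-moveParticle (proj₁ x) _ p v≢w))
      lw' : 1 ≤ proj₁ y w
      lw' = subst (1 ≤_) (proj₁ fired-v w q) (≤-trans lw (≤-moveParticle (proj₁ x) _ q w≢v))
      fired-w' : fire y w q ≋ fire x' v p
      fired-w' = ≋-trans (fire-cong w q (≋-sym fired-v))
                 (≋-trans (fire-comm x q p w≢v lw lv) (fire-cong v p fired-w))

    halted-unique : ∀ {x h h'} → Run A x h → Halted h → Run A x h' → Halted h' → h ≋ h'
    halted-unique [ x≋h ] _ [ x≋h' ] _ = ≋-trans (≋-sym x≋h) x≋h'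
    halted-unique (m ∷ _) _ [ x≋h' ] halted' = ⊥-elim (halted-stuck (halted-cong (≋-sym x≋h') halted') m)
    halted-unique r halted (m ∷ r') halted' = halted-unique (exchange r halted m) halted r' halted'

  step⇒move : ∀ {x y} → Step G x y → Move everywhere x y
  step⇒move (step σ ρ v p loaded) = move v p refl loaded ≋-refl

  steps⇒run : ∀ {x y} → Star (Step G) x y → x ⇝ y
  steps⇒run ε = [ ≋-refl ]
  steps⇒run (s ◅ ss) = step⇒move s ∷ steps⇒run ss

  run⇒steps : ∀ {A x x' y} → x ≋ x' → Run A x' y → ∃[ y' ] (Star (Step G) x y' × y' ≋ y)
  run⇒steps {x = x} x≋x' [ x'≋y ] = x , ε , ≋-trans x≋x' x'≋y
  run⇒steps {x = σ , ρ} x≋x' (move v p _ loaded fired ∷ r)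
    with run⇒steps (≋-trans (fire-cong v p x≋x') fired) r
  ... | y' , ss , y'≋y = y' , step σ ρ v p (subst (1 ≤_) (sym (proj₁ x≋x' v p)) loaded) ◅ ss , y'≋y

  -- σρ = r in the notation of the paper, up to pointwise equality on V₀
  RoutesTo : PConfig G → RotorConfig G → RotorConfig G → Set
  RoutesTo σ ρ r = ∃[ h ] ((σ , ρ) ⇝ h × Halted h × _≈ʳ_ G (proj₂ h) r)

  routes⇒routesTo : ∀ {σ ρ r} → Routes G σ ρ r → RoutesTo σ ρ r
  routes⇒routesTo {r = r} (σ' , ss , halted) = (σ' , r) , steps⇒run ss , halted , (λ _ _ → refl)

  routesTo⇒routes : ∀ {σ ρ r} → RoutesTo σ ρ r → ∃[ r' ] (Routes G σ ρ r' × _≈ʳ_ G r' r)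
  routesTo⇒routes (h , run , halted , h≈r) with run⇒steps ≋-refl run
  ... | (σ' , r') , ss , y'≋h =
    r' , (σ' , ss , halted-cong (≋-sym y'≋h) halted) , (λ v p → trans (proj₂ y'≋h v p) (h≈r v p))

  routesTo-cong : ∀ {σ σ' ρ r r'} → _≈ᵖ_ G σ σ' → RoutesTo σ' ρ r → _≈ʳ_ G r r' → RoutesTo σ ρ r'
  routesTo-cong σ≈σ' (h , run , halted , h≈r) r≈r' =
    h , run-cong-src (σ≈σ' , (λ _ _ → refl)) run , halted , (λ v p → trans (h≈r v p) (r≈r' v p))

  routesTo-unique : ∀ {σ ρ r r'} → RoutesTo σ ρ r → RoutesTo σ ρ r' → _≈ʳ_ G r r'
  routesTo-unique (h , run , halted , h≈r) (h' , run' , halted' , h'≈r') v p =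
    trans (sym (h≈r v p)) (trans (proj₂ (halted-unique run halted run' halted') v p) (h'≈r' v p))

  sameResult⇒routesTo : ∀ {σ ρ ρ'} → SameResult G σ ρ ρ' → ∃[ r ] (RoutesTo σ ρ r × RoutesTo σ ρ' r)
  sameResult⇒routesTo (r , r' , routes , routes' , r≈r') =
    r , routes⇒routesTo routes , routesTo-cong (λ _ _ → refl) (routes⇒routesTo routes') (λ v p → sym (r≈r' v p))

  routesTo⇒sameResult : ∀ {σ ρ ρ' r} → RoutesTo σ ρ r → RoutesTo σ ρ' r → SameResult G σ ρ ρ'
  routesTo⇒sameResult routesTo routesTo' with routesTo⇒routes routesTo | routesTo⇒routes routesTo'
  ... | r , routes , r≈ | r' , routes' , r'≈ =
    r , r' , routes , routes' , (λ v p → trans (r≈ v p) (sym (r'≈ v p)))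

  addParticles : PConfig G → State → State
  addParticles τ (σ , ρ) = _⊕_ G σ τ , ρ

  addParticles-cong : ∀ τ {x y} → x ≋ y → addParticles τ x ≋ addParticles τ y
  addParticles-cong τ (σ≈ , ρ≈) = (λ u q → cong (_+ τ u) (σ≈ u q)) , ρ≈

  moveParticle-⊕ : ∀ σ τ {v} w → 1 ≤ σ v →
                   _≈ᵖ_ G (moveParticle (_⊕_ G σ τ) v w) (_⊕_ G (moveParticle σ v w) τ)
  moveParticle-⊕ σ τ {v} w loaded u q rewrite q = begin
    σ u + τ u ∸ δ G v u + δ G w u    ≡⟨ cong (_+ δ G w u) (+-∸-comm (τ u) (δ-≤ σ u loaded)) ⟩
    σ u ∸ δ G v u + τ u + δ G w u    ≡⟨ +-assoc (σ u ∸ δ G v u) (τ u) _ ⟩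
    σ u ∸ δ G v u + (τ u + δ G w u)  ≡⟨ cong (σ u ∸ δ G v u +_) (+-comm (τ u) _) ⟩
    σ u ∸ δ G v u + (δ G w u + τ u)  ≡⟨ +-assoc (σ u ∸ δ G v u) _ (τ u) ⟨
    σ u ∸ δ G v u + δ G w u + τ u    ∎
    where open ≡-Reasoning

  run-addParticles : ∀ {A} τ {x y} → Run A x y → Run A (addParticles τ x) (addParticles τ y)
  run-addParticles τ [ x≋y ] = [ addParticles-cong τ x≋y ]
  run-addParticles τ {σ , ρ} (move v p a loaded fired ∷ r) =
    move v p a (≤-trans loaded (m≤m+n _ _))
      (≋-trans (moveParticle-⊕ σ τ _ loaded , (λ _ _ → refl)) (addParticles-cong τ fired))
    ∷ run-addParticles τ r

  -- Toppling as repeated firing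
  module Toppling (σ : PConfig G) (ρ : RotorConfig G) (v : Fin n) (p : NonTarget G v) where

    instance
      d-nonZero : NonZero (d v)
      d-nonZero = nonZeroIndex (ρ v p)

    fires : ℕ → State
    fires zero = σ , ρ
    fires (suc k) = fire (fires k) v p

    fires-rotor-self : ∀ k q → proj₂ (fires k) v q ≡ (toℕ (ρ v q) + k) mod d v
    fires-rotor-self zero q = trans (sym (mod-toℕ (ρ v q))) (cong (_mod d v) (sym (+-identityʳ _)))
    fires-rotor-self (suc k) q = begin
      advance G (proj₂ (fires k)) v v q  ≡⟨ advance-self _ v q ⟩
      cyc (proj₂ (fires k) v q)          ≡⟨ cong cyc (fires-rotor-self k q) ⟩
      cyc ((toℕ (ρ v q) + k) mod d v)    ≡⟨ cyc-mod (toℕ (ρ v q) + k) ⟩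
      suc (toℕ (ρ v q) + k) mod d v      ≡⟨ cong (_mod d v) (+-suc _ k) ⟨
      (toℕ (ρ v q) + suc k) mod d v      ∎
      where open ≡-Reasoning

    fires-rotor-other : ∀ k {u} q → u ≢ v → proj₂ (fires k) u q ≡ ρ u q
    fires-rotor-other zero q u≢v = refl
    fires-rotor-other (suc k) q u≢v = trans (advance-other _ q u≢v) (fires-rotor-other k q u≢v)

    leadsTo : Fin n → Fin (d v) → ℕ
    leadsTo u i = if [_≡?_] G (head v i) u then 1 else 0

    received : ℕ → Fin n → ℕ
    received k u = ∑-window (λ j → leadsTo u (j mod d v)) (suc (toℕ (ρ v p))) k

    received-all : ∀ u → received (d v) u ≡ arcs G v u
    received-all u = trans
      (∑-window-periodic (λ j → leadsTo u (j mod d v)) (d v) (λ j → cong (leadsTo u) (mod-+-period j)) _)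
      (∑-window-countFin G (d v) _ (λ j → leadsTo u (j mod d v)) 0 (λ i → cong (leadsTo u) (mod-toℕ i)))

    sentFrom : ℕ → Fin n → ℕ
    sentFrom k u = if [_≡?_] G u v then k else 0

    sentFrom-zero : ∀ u → sentFrom 0 u ≡ 0
    sentFrom-zero u with [_≡?_] G u v
    ... | true = refl
    ... | false = refl

    moveParticle-sentFrom : ∀ σ' w k u → NonTarget G u → 1 ≤ σ' v →
                            moveParticle σ' v w u + sentFrom (suc k) u ≡ σ' u + sentFrom k u + δ G w u
    moveParticle-sentFrom σ' w k u q loaded rewrite q with u ≟ v
    ... | yes refl = shuffle (σ' u) loaded
      where
      shuffle : ∀ s → 1 ≤ s → s ∸ 1 + δ G w u + suc k ≡ s + k + δ G w u
      shuffle (suc s) _ = trans (+-suc (s + δ G w u) k) (cong suc (trans (+-assoc s _ k)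
                            (trans (cong (s +_) (+-comm (δ G w u) k)) (sym (+-assoc s k _)))))
    ... | no _ = trans (+-identityʳ _) (cong (_+ δ G w u) (sym (+-identityʳ (σ' u))))

    fires-loaded : ∀ k → suc k ≤ σ v → 1 ≤ proj₁ (fires k) v

    fires-particles : ∀ k → k ≤ σ v → ∀ u → NonTarget G u →
                      proj₁ (fires k) u + sentFrom k u ≡ σ u + received k u
    fires-particles zero _ u q = cong (σ u +_) (sentFrom-zero u)
    fires-particles (suc k) 1+k≤σv u q = begin
      moveParticle y v w u + sentFrom (suc k) u  ≡⟨ moveParticle-sentFrom y w k u q (fires-loaded k 1+k≤σv) ⟩
      y u + sentFrom k u + δ G w u               ≡⟨ cong₂ _+_ (fires-particles k k≤σv u q) lands ⟩
      σ u + received k u + leadsTo u j           ≡⟨ +-assoc (σ u) _ _ ⟩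
      σ u + (received k u + leadsTo u j)
        ≡⟨ cong (σ u +_) (∑-window-snoc (λ j → leadsTo u (j mod d v)) (suc a) k) ⟨
      σ u + received (suc k) u                   ∎
      where
      open ≡-Reasoning
      a = toℕ (ρ v p)
      y = proj₁ (fires k)
      w = head v (cyc (proj₂ (fires k) v p))
      j = suc (a + k) mod d v
      k≤σv : k ≤ σ v
      k≤σv = ≤-trans (n≤1+n k) 1+k≤σv
      lands : δ G w u ≡ leadsTo u j
      lands = trans (cong (if_then 1 else 0) (⌊≟⌋-sym u w))
                    (cong (leadsTo u) (trans (cong cyc (fires-rotor-self k p)) (cyc-mod _)))

    fires-loaded k 1+k≤σv = +-cancelʳ-≤ k 1 _ (begin
      1 + k                                   ≤⟨ 1+k≤σv ⟩
      σ v                                     ≤⟨ m≤m+n (σ v) _ ⟩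
      σ v + received k v                      ≡⟨ fires-particles k (≤-trans (n≤1+n k) 1+k≤σv) v p ⟨
      proj₁ (fires k) v + sentFrom k v        ≡⟨ cong (proj₁ (fires k) v +_) (if-true (⌊≟⌋-refl v)) ⟩
      proj₁ (fires k) v + k                   ∎)
      where open ≤-Reasoning

    fires-run : ∀ k → k ≤ σ v → (σ , ρ) ⇝ fires k
    fires-run zero _ = [ ≋-refl ]
    fires-run (suc k) 1+k≤σv =
      fires-run k (≤-trans (n≤1+n k) 1+k≤σv) ++ (move v p refl (fires-loaded k 1+k≤σv) ≋-refl ∷ [ ≋-refl ])

  topple-run : ∀ {σ σ'} → Topple G σ σ' → ∀ ρ → (σ , ρ) ⇝ (σ' , ρ)
  topple-run (topple σ v p d≤σv) ρ = run-cong-tgt (fires-run (d v) d≤σv) (particles , rotors)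
    where
    open Toppling σ ρ v p
    sentFrom-≤ : ∀ u → sentFrom (d v) u ≤ σ u
    sentFrom-≤ u with u ≟ v
    ... | yes refl = d≤σv
    ... | no _ = z≤n
    particles : ∀ u → NonTarget G u →
                proj₁ (fires (d v)) u ≡ (if T u then σ u else (σ u ∸ sentFrom (d v) u) + arcs G v u)
    particles u q = begin
      y u                                      ≡⟨ m+n∸n≡m (y u) (sentFrom (d v) u) ⟨
      y u + sentFrom (d v) u ∸ sentFrom (d v) u
        ≡⟨ cong (_∸ sentFrom (d v) u) (fires-particles (d v) d≤σv u q) ⟩
      σ u + received (d v) u ∸ sentFrom (d v) u  ≡⟨ cong (λ t → σ u + t ∸ sentFrom (d v) u) (received-all u) ⟩
      σ u + arcs G v u ∸ sentFrom (d v) u        ≡⟨ +-∸-comm (arcs G v u) (sentFrom-≤ u) ⟩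
      σ u ∸ sentFrom (d v) u + arcs G v u        ≡⟨ if-false q ⟨
      (if T u then σ u else (σ u ∸ sentFrom (d v) u) + arcs G v u) ∎
      where
      open ≡-Reasoning
      y = proj₁ (fires (d v))
    rotors : _≈ʳ_ G (proj₂ (fires (d v))) ρ
    rotors u q with u ≟ v
    ... | yes refl = trans (fires-rotor-self (d v) q) (trans (mod-+-period _) (mod-toℕ _))
    ... | no u≢v = fires-rotor-other (d v) q u≢v

  -- Every state halts
  run-weaken : ∀ {A B} → (∀ u → A u ≡ true → B u ≡ true) → ∀ {x y} → Run A x y → Run B x y
  run-weaken A⊆B [ x≋y ] = [ x≋y ]
  run-weaken A⊆B (move v p a loaded fired ∷ r) = move v p (A⊆B v a) loaded fired ∷ run-weaken A⊆B r

  run-rotor-inactive : ∀ {A x y u} → Run A x y → A u ≡ false → ∀ q → proj₂ y u q ≡ proj₂ x u q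
  run-rotor-inactive [ x≋y ] _ q = sym (proj₂ x≋y _ q)
  run-rotor-inactive {u = u} (move v p a _ fired ∷ r) au q =
    trans (run-rotor-inactive r au q) (trans (sym (proj₂ fired u q)) (advance-other _ q u≢v))
    where
    u≢v : u ≢ v
    u≢v refl with () ← trans (sym au) a

  AvoidsTargets : VertexSet → Set
  AvoidsTargets A = ∀ u → A u ≡ true → NonTarget G u

  load : VertexSet → PConfig G → ℕ
  load A σ = ∑[ u < n ] (if A u then σ u else 0)

  load-moveParticle : ∀ {A} → AvoidsTargets A → ∀ σ {v} w → A v ≡ true → 1 ≤ σ v →
                      load A (moveParticle σ v w) + 1 ≡ load A σ + (if A w then 1 else 0)
  load-moveParticle {A} avoids σ {v} w av loaded = begin
    load A σ' + 1                                          ≡⟨ cong (load A σ' +_) (∑-indicator v 1) ⟨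
    load A σ' + ∑[ u < n ] δ G v u                         ≡⟨ ∑-distrib-+ _ (δ G v) ⟨
    ∑[ u < n ] ((if A u then σ' u else 0) + δ G v u)       ≡⟨ sum-cong-≗ pointwise ⟩
    ∑[ u < n ] ((if A u then σ u else 0) + arrives u)      ≡⟨ ∑-distrib-+ _ arrives ⟩
    load A σ + ∑[ u < n ] arrives u                        ≡⟨ cong (load A σ +_) (∑-indicator w _) ⟩
    load A σ + (if A w then 1 else 0)                      ∎
    where
    open ≡-Reasoning
    σ' = moveParticle σ v w
    arrives : Fin n → ℕ
    arrives u = if ⌊ u ≟ w ⌋ then (if A w then 1 else 0) else 0
    pointwise : ∀ u → (if A u then σ' u else 0) + δ G v u ≡ (if A u then σ u else 0) + arrives u
    pointwise u with A u in au | u ≟ v | u ≟ w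
    ... | false | yes refl | _ with () ← trans (sym au) av
    ... | false | no _ | yes refl rewrite au = refl
    ... | false | no _ | no _ = refl
    ... | true | yes refl | yes refl rewrite avoids u au | au = m∸1+n+1≡m+n (σ u) 1 loaded
    ... | true | yes refl | no _ rewrite avoids u au = m∸1+n+1≡m+n (σ u) 0 loaded
    ... | true | no _ | yes refl rewrite avoids u au | au = +-identityʳ _
    ... | true | no _ | no _ rewrite avoids u au = +-identityʳ _

  load-cong : ∀ {A} → AvoidsTargets A → ∀ {σ τ} → _≈ᵖ_ G σ τ → load A σ ≡ load A τ
  load-cong {A} avoids {σ} {τ} σ≈τ = sum-cong-≗ pointwise
    where
    pointwise : ∀ u → (if A u then σ u else 0) ≡ (if A u then τ u else 0)
    pointwise u with A u in au
    ... | true = σ≈τ u (avoids u au)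
    ... | false = refl

  load-moveParticle-≤ : ∀ {A} → AvoidsTargets A → ∀ σ {v} w → A v ≡ true → 1 ≤ σ v →
                        load A (moveParticle σ v w) ≤ load A σ
  load-moveParticle-≤ {A} avoids σ w av loaded = +-cancelʳ-≤ 1 _ _ (begin
    load A (moveParticle σ _ w) + 1      ≡⟨ load-moveParticle avoids σ w av loaded ⟩
    load A σ + (if A w then 1 else 0)    ≤⟨ +-monoʳ-≤ (load A σ) (indicator-≤-1 (A w)) ⟩
    load A σ + 1                         ∎)
    where
    open ≤-Reasoning
    indicator-≤-1 : ∀ b → (if b then 1 else 0) ≤ 1
    indicator-≤-1 true = ≤-refl
    indicator-≤-1 false = z≤n

  load-run : ∀ {A} → AvoidsTargets A → ∀ {x y} → Run A x y → load A (proj₁ y) ≤ load A (proj₁ x)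
  load-run avoids [ x≋y ] = ≤-reflexive (load-cong avoids (λ u q → sym (proj₁ x≋y u q)))
  load-run {A} avoids {σ , ρ} {z} (_∷_ {y = y} (move v p a loaded fired) r) = begin
    load A (proj₁ z)                                       ≤⟨ load-run avoids r ⟩
    load A (proj₁ y)                                       ≡⟨ load-cong avoids (λ u q → sym (proj₁ fired u q)) ⟩
    load A (moveParticle σ v (head v (cyc (ρ v p))))       ≤⟨ load-moveParticle-≤ avoids σ _ a loaded ⟩
    load A σ                                               ∎
    where open ≤-Reasoning

  Drained : VertexSet → State → Set
  Drained A x = ∃[ y ] (Run A x y × (∀ u → A u ≡ true → proj₁ y u ≡ 0))

  _∖_ : VertexSet → Fin n → VertexSet
  (A ∖ v) u = A u ∧ not ([_≡?_] G u v)

  ∖-⊆ : ∀ (A : VertexSet) v u → (A ∖ v) u ≡ true → A u ≡ true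
  ∖-⊆ A v u eq with A u
  ... | true = refl

  ∖-self : ∀ (A : VertexSet) v → (A ∖ v) v ≡ false
  ∖-self A v rewrite ⌊≟⌋-refl v = Bool.∧-zeroʳ (A v)

  ∖-other : ∀ (A : VertexSet) {v u} → A u ≡ true → u ≢ v → (A ∖ v) u ≡ true
  ∖-other A au u≢v rewrite au | ⌊≟⌋-≢ u≢v = refl

  -- v is active and its arc i leaves the active set; every other active vertex is drained by the
  -- induction hypothesis, after which firing v either moves its rotor closer to i or, when the rotor
  -- reaches i, pushes a particle out of the active set
  module Drain {A : VertexSet} (avoids : AvoidsTargets A) {v : Fin n} (av : A v ≡ true)
               (i : Fin (d v)) (exit : A (head v i) ≡ false)
               (drain-rest : ∀ x → Drained (A ∖ v) x) where

    p : NonTarget G v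
    p = avoids v av

    potential : State → ℕ
    potential x = gap i (proj₂ x v p) + load A (proj₁ x) * d v

    potential-fire : ∀ x → 1 ≤ proj₁ x v → potential (fire x v p) < potential x
    potential-fire (σ , ρ) loaded with gap-cyc i (ρ v p)
    ... | inj₁ hit = begin-strict
      gap i (advance G ρ v v p) + load A σ' * d v
        ≡⟨ cong (λ r → gap i r + load A σ' * d v) (trans (advance-self ρ v p) hit) ⟩
      gap i i + load A σ' * d v                    ≡⟨ cong (_+ load A σ' * d v) (gap-self i) ⟩
      suc (load A σ') * d v                        ≡⟨ cong (_* d v) (trans (+-comm 1 _) unloads) ⟩
      load A σ * d v                               <⟨ m<n+m _ (gap-positive i (ρ v p)) ⟩
      gap i (ρ v p) + load A σ * d v               ∎
      where
      open ≤-Reasoning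
      σ' = moveParticle σ v (head v (cyc (ρ v p)))
      unloads : load A σ' + 1 ≡ load A σ
      unloads = trans (load-moveParticle avoids σ _ av loaded)
                      (trans (cong (λ j → load A σ + (if A (head v j) then 1 else 0)) hit)
                             (trans (cong (λ b → load A σ + (if b then 1 else 0)) exit) (+-identityʳ _)))
    ... | inj₂ closer = begin-strict
      gap i (advance G ρ v v p) + load A σ' * d v
        ≡⟨ cong (λ r → gap i r + load A σ' * d v) (advance-self ρ v p) ⟩
      gap i (cyc (ρ v p)) + load A σ' * d v
        <⟨ +-mono-<-≤ closer (*-monoˡ-≤ (d v) (load-moveParticle-≤ avoids σ _ av loaded)) ⟩
      gap i (ρ v p) + load A σ * d v               ∎
      where
      open ≤-Reasoning
      σ' = moveParticle σ v (head v (cyc (ρ v p)))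

    potential-run-rest : ∀ {x y} → Run (A ∖ v) x y → potential y ≤ potential x
    potential-run-rest {x} {y} run = +-mono-≤
      (≤-reflexive (cong (gap i) (run-rotor-inactive run (∖-self A v) p)))
      (*-monoˡ-≤ (d v) (load-run avoids (run-weaken (∖-⊆ A v) run)))

    drain : ∀ k x → potential x < k → Drained A x
    drain (suc k) x μx≤k with drain-rest x
    ... | y , run , emptied = continue (proj₁ y v ℕ.≟ 0)
      where
      continue : Dec (proj₁ y v ≡ 0) → Drained A x
      continue (yes y-v≡0) = y , run-weaken (∖-⊆ A v) run , all-empty
        where
        all-empty : ∀ u → A u ≡ true → proj₁ y u ≡ 0
        all-empty u au with u ≟ v
        ... | yes refl = y-v≡0
        ... | no u≢v = emptied u (∖-other A au u≢v)
      continue (no y-v≢0) with drain k (fire y v p) decreased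
        where
        decreased : potential (fire y v p) < k
        decreased = <-≤-trans (potential-fire y (n≢0⇒n>0 y-v≢0))
                              (≤-trans (potential-run-rest run) (s≤s⁻¹ μx≤k))
      ... | z , run' , emptied' =
        z , (run-weaken (∖-⊆ A v) run ++ move v p av (n≢0⇒n>0 y-v≢0) ≋-refl ∷ run') , emptied'

  count : VertexSet → ℕ
  count A = load A (λ _ → 1)

  count-∖ : ∀ (A : VertexSet) {v} → A v ≡ true → suc (count (A ∖ v)) ≡ count A
  count-∖ A {v} av = begin
    suc (count (A ∖ v))                                   ≡⟨ +-comm 1 _ ⟩
    count (A ∖ v) + 1                                     ≡⟨ cong (count (A ∖ v) +_) (∑-indicator v 1) ⟨
    count (A ∖ v) + ∑[ u < n ] δ G v u                    ≡⟨ ∑-distrib-+ _ (δ G v) ⟨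
    ∑[ u < n ] ((if (A ∖ v) u then 1 else 0) + δ G v u)   ≡⟨ sum-cong-≗ pointwise ⟩
    count A                                               ∎
    where
    open ≡-Reasoning
    pointwise : ∀ u → (if (A ∖ v) u then 1 else 0) + δ G v u ≡ (if A u then 1 else 0)
    pointwise u with u ≟ v
    ... | yes refl rewrite av = refl
    ... | no _ rewrite Bool.∧-identityʳ (A u) = +-identityʳ _

  ExitsReachable : VertexSet → Set
  ExitsReachable A = ∀ u → A u ≡ true → ∃[ t ] (Star (Arc G) u t × A t ≡ false)

  exit-arc : ∀ (A : VertexSet) {u t} → A u ≡ true → Star (Arc G) u t → A t ≡ false →
             ∃[ v ] Σ (Fin (d v)) λ i → A v ≡ true × A (head v i) ≡ false
  exit-arc A au ε at with () ← trans (sym au) at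
  exit-arc A {u} au ((i , refl) ◅ path) at with A (head u i) Bool.≟ true
  ... | yes a-next = exit-arc A a-next path at
  ... | no a-next = u , i , au , Bool.¬-not a-next

  exits-∖ : ∀ (A : VertexSet) v → ExitsReachable A → ExitsReachable (A ∖ v)
  exits-∖ A v exits u a with exits u (∖-⊆ A v u a)
  ... | t , path , at = t , path , cong (λ b → b ∧ not ([_≡?_] G t v)) at

  drains : ∀ k (A : VertexSet) → count A < k → AvoidsTargets A → ExitsReachable A → ∀ x → Drained A x
  drains (suc k) A count<k avoids exits x with any? (λ u → A u Bool.≟ true)
  ... | no none = x , [ ≋-refl ] , (λ u au → ⊥-elim (none (u , au)))
  ... | yes (u , au) with exits u au
  ...   | t , path , at with exit-arc A au path at
  ...     | v , i , av , exit = Drain.drain avoids av i exit drain-rest _ x ≤-refl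
    where
    drain-rest : ∀ x → Drained (A ∖ v) x
    drain-rest = drains k (A ∖ v) (subst (_≤ k) (sym (count-∖ A av)) (s≤s⁻¹ count<k))
                   (λ u a → avoids u (∖-⊆ A v u a)) (exits-∖ A v exits)

  halts : StronglyConnected G → TargetsNonempty G → ∀ x → ∃[ h ] (x ⇝ h × Halted h)
  halts connected (t , target) x with drains (suc (count V₀)) V₀ ≤-refl avoids exits x
    where
    V₀ : VertexSet
    V₀ u = not (T u)
    avoids : AvoidsTargets V₀
    avoids u a = Bool.not-injective a
    exits : ExitsReachable V₀
    exits u _ = t , connected u t , cong not target
  ... | h , run , emptied = h , run-weaken (λ _ _ → refl) run , (λ u q → emptied u (cong not q))

  -- Invariance of σρ
  routesTo-⊕ : ∀ {σ τ ρ r q} → RoutesTo σ ρ r → RoutesTo τ r q → RoutesTo (_⊕_ G σ τ) ρ q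
  routesTo-⊕ {τ = τ} (h , run , halted , h≈r) (h' , run' , halted' , h'≈q) =
    h' , run-cong-tgt (run-addParticles τ run) (arrived , h≈r) ++ run' , halted' , h'≈q
    where
    arrived : _≈ᵖ_ G (proj₁ (addParticles τ h)) τ
    arrived u q = cong (_+ τ u) (halted u q)

  module _ (connected : StronglyConnected G) (targets : TargetsNonempty G) where

    routesTo-exists : ∀ σ ρ → ∃[ r ] RoutesTo σ ρ r
    routesTo-exists σ ρ with halts connected targets (σ , ρ)
    ... | h , run , halted = proj₂ h , h , run , halted , (λ _ _ → refl)

    routesTo-run : ∀ {σ σ' ρ r} → (σ , ρ) ⇝ (σ' , ρ) → RoutesTo σ ρ r → RoutesTo σ' ρ r
    routesTo-run {σ' = σ'} {ρ} run routes with routesTo-exists σ' ρ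
    ... | _ , h , run' , halted , _ =
      h , run' , halted , routesTo-unique (h , run ++ run' , halted , (λ _ _ → refl)) routes

    routesTo-stabilizes : ∀ {σ τ ρ r} → StabilizesTo G σ τ → RoutesTo σ ρ r → RoutesTo τ ρ r
    routesTo-stabilizes {ρ = ρ} (τ' , topples , _ , τ'≈τ) routes =
      routesTo-cong (λ v p → sym (τ'≈τ v p)) (along topples routes) (λ _ _ → refl)
      where
      along : ∀ {σ σ' r} → Star (Topple G) σ σ' → RoutesTo σ ρ r → RoutesTo σ' ρ r
      along ε routes = routes
      along (t ◅ ts) routes = along ts (routesTo-run (topple-run t ρ) routes)

    sameResult-⊕ : ∀ {σ ρ ρ'} → SameResult G σ ρ ρ' → ∀ τ → SameResult G (_⊕_ G σ τ) ρ ρ'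
    sameResult-⊕ same τ with sameResult⇒routesTo same
    ... | r , routes , routes' with routesTo-exists τ r
    ...   | q , onward = routesTo⇒sameResult (routesTo-⊕ routes onward) (routesTo-⊕ routes' onward)

    sameResult-stabilizes : ∀ {σ τ ρ ρ'} → StabilizesTo G σ τ → SameResult G σ ρ ρ' → SameResult G τ ρ ρ'
    sameResult-stabilizes stab same with sameResult⇒routesTo same
    ... | r , routes , routes' =
      routesTo⇒sameResult (routesTo-stabilizes stab routes) (routesTo-stabilizes stab routes')

  sameResult-cong : ∀ {σ σ' ρ ρ'} → _≈ᵖ_ G σ σ' → SameResult G σ' ρ ρ' → SameResult G σ ρ ρ'
  sameResult-cong σ≈σ' same with sameResult⇒routesTo same
  ... | r , routes , routes' =
    routesTo⇒sameResult (routesTo-cong σ≈σ' routes (λ _ _ → refl))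
                        (routesTo-cong σ≈σ' routes' (λ _ _ → refl))

lemma3p1 : (G : RotorGraph) → StronglyConnected G → TargetsNonempty G →
    (ρ ρ' : RotorConfig G) → (e : PConfig G) → IsIdentity G e →
    let A = ∃[ σ ] SameResult G σ ρ ρ'
        B = ∀ σ → Recurrent G σ → SameResult G σ ρ ρ'
        C = SameResult G e ρ ρ'
        D = ∀ σ → (∀ v → NonTarget G v → e v ≤ σ v) → SameResult G σ ρ ρ'
    in (A → B) × (B → C) × (C → D) × (D → A)
-- only the recurrence of e is needed
lemma3p1 G connected targets ρ ρ' e (e-recurrent , _) = A⇒B , B⇒C , C⇒D , D⇒A
  where
  open Rotor G
  A⇒B : ∃[ σ ] SameResult G σ ρ ρ' → ∀ τ → Recurrent G τ → SameResult G τ ρ ρ'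
  A⇒B (σ , same) τ (_ , reachable) with reachable σ
  ... | τ' , stab = sameResult-stabilizes connected targets stab
                      (sameResult-cong (λ u _ → +-comm (τ' u) (σ u)) (sameResult-⊕ connected targets same τ'))
  B⇒C : (∀ σ → Recurrent G σ → SameResult G σ ρ ρ') → SameResult G e ρ ρ'
  B⇒C all = all e e-recurrent
  C⇒D : SameResult G e ρ ρ' → ∀ σ → (∀ v → NonTarget G v → e v ≤ σ v) → SameResult G σ ρ ρ'
  C⇒D same σ e≤σ = sameResult-cong (λ v p → sym (m+[n∸m]≡n (e≤σ v p)))
                     (sameResult-⊕ connected targets same (λ u → σ u ∸ e u))
  D⇒A : (∀ σ → (∀ v → NonTarget G v → e v ≤ σ v) → SameResult G σ ρ ρ') →
        ∃[ σ ] SameResult G σ ρ ρ'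
  D⇒A all = e , all e (λ _ _ → ≤-refl)
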